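{- Let $G=(A,B,E)$ and $H=(C,D,F)$ be balanced bipartite graphs (with $|A|=|B|=n$, $|C|=|D|=m$). If $G$ is $\alpha$-stable and $H$ is $\alpha^+$-stable, then their Kronecker product $G\otimes H$ is $\alpha$-stable.
   Context: All graphs are finite and simple. The Kronecker product $G\otimes H=(A\times C,B\times D,U)$ is the bipartite graph with classes $A\times C$ and $B\times D$ in which $(a,c)(b,d)\in U$ if and only if $ab\in E$ and $cd\in F$. $\alpha(G)$ is the largest size of a stable set. A graph is $\alpha^-$-stable if $\alpha(G-e)=\alpha(G)$ for every edge $e$; $\alpha^+$-stable if $\alpha(G+e)=\alpha(G)$ for every pair $e=xy$ of distinct nonadjacent vertices; $\alpha$-stable if both. -}

module Defs where

open import Data.Nat using (ℕ; _≤_)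
open import Data.Fin using (Fin)
open import Data.Product using (Σ; _×_; _,_; ∃-syntax)
open import Data.Sum using (_⊎_; inj₁; inj₂)
open import Data.Empty using (⊥)
open import Data.List using (List; length)
open import Data.List.Membership.Propositional using (_∈_)
open import Data.List.Relation.Unary.Unique.Propositional using (Unique)
open import Relation.Nullary using (¬_)
open import Relation.Binary.PropositionalEquality using (_≡_; _≢_)
open import Function.Bundles using (_⇔_)

record Graph : Set₁ where
  field
    V   : Set
    Adj : V → V → Set
open Graph public

bip : (A B : Set) → (A → B → Set) → Graph
bip A B E = record { V = A ⊎ B ; Adj = adj }
  where
  adj : A ⊎ B → A ⊎ B → Set
  adj (inj₁ a) (inj₂ b) = E a b
  adj (inj₂ b) (inj₁ a) = E a b
  adj (inj₁ _) (inj₁ _) = ⊥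
  adj (inj₂ _) (inj₂ _) = ⊥

BipEdges : ℕ → Set₁
BipEdges n = Fin n → Fin n → Set

balanced : (n : ℕ) → BipEdges n → Graph
balanced n E = bip (Fin n) (Fin n) E

kron : {n m : ℕ} → BipEdges n → BipEdges m → Graph
kron {n} {m} E F =
  bip (Fin n × Fin m) (Fin n × Fin m) (λ { (a , c) (b , d) → E a b × F c d })

IsStable : (G : Graph) → List (V G) → Set
IsStable G S = Unique S × (∀ {u v} → u ∈ S → v ∈ S → ¬ Adj G u v)

IsAlpha : Graph → ℕ → Set
IsAlpha G k = (∃[ S ] (IsStable G S × length S ≡ k))
            × (∀ S → IsStable G S → length S ≤ k)

SameAlpha : Graph → Graph → Set
SameAlpha G G′ = ∀ k → IsAlpha G k ⇔ IsAlpha G′ k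

SamePair : {X : Set} → X → X → X → X → Set
SamePair u v x y = (u ≡ x × v ≡ y) ⊎ (u ≡ y × v ≡ x)

deleteEdge : (G : Graph) → V G → V G → Graph
deleteEdge G x y = record { V = V G ; Adj = λ u v → Adj G u v × ¬ SamePair u v x y }

addEdge : (G : Graph) → V G → V G → Graph
addEdge G x y = record { V = V G ; Adj = λ u v → Adj G u v ⊎ SamePair u v x y }

α⁻-stable : Graph → Set
α⁻-stable G = ∀ x y → Adj G x y → SameAlpha G (deleteEdge G x y)

α⁺-stable : Graph → Set
α⁺-stable G = ∀ x y → x ≢ y → ¬ Adj G x y → SameAlpha G (addEdge G x y)

α-stable : Graph → Set
α-stable G = α⁻-stable G × α⁺-stable G

-- Encode a stable set of a bipartite graph on A ⊎ B as a pair (P, Q) with P ⊆ A and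
-- Q ⊆ B. If G is balanced and α⁺-stable then α(G) = n: otherwise the maximum stable pairs are
-- closed under (P ∩ P′, Q ∪ Q′) and (P ∪ P′, Q ∩ Q′), since the sizes of these two stable pairs
-- add up to twice the maximum. Hence a maximum pair with smallest P has its P inside every maximum
-- pair, and as α(G) > n this P is non-empty; symmetrically on the B side. This gives non-adjacent
-- x ∈ A and y ∈ B lying in every maximum stable set, so adding xy lowers α.
--
-- With α(G) = n and α(H) = m, let S be a stable set of G ⊗ H. For each edge cd of H the fibres
-- {a | (a,c) ∈ S} and {b | (b,d) ∈ S} form a stable pair of G, so their sizes s_c and t_d satisfy
-- s_c + t_d ≤ n. Cutting the weights s and t into n threshold layers, each a stable pair of H,
-- gives Σ s + Σ t ≤ n m, a bound attained by either side of G ⊗ H. Adding an edge to G ⊗ H leaves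
-- one side stable. Deleting the edge (a,c)(b,d) only weakens the fibre condition to stability in
-- G − ab, and α(G − ab) = n because G is α⁻-stable.

module Submission where

open import Data.Bool.Base using (Bool; true; false; T; _∧_; _∨_)
open import Data.Bool.Properties using (T-∧; T-∨)
open import Data.Empty using (⊥; ⊥-elim)
open import Data.Fin.Base using (Fin; zero; suc)
open import Data.Fin.Properties using (_≟_)
open import Data.List.Base
  using (List; []; _∷_; length; map; _++_; filter; allFin; tabulate; concat; cartesianProduct)
open import Data.List.Properties using (length-++; length-map; length-tabulate)
open import Data.List.Membership.Propositional using (_∈_; _∉_)
open import Data.List.Membership.Propositional.Properties
  using ( ∈-∃++; ∈-++⁻; ∈-++⁺ˡ; ∈-++⁺ʳ; ∈-map⁺; ∈-map⁻; ∈-filter⁺; ∈-filter⁻; ∈-allFin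
        ; ∈-concat⁺′; ∈-tabulate⁺ )
open import Data.List.Relation.Binary.Disjoint.Propositional using (Disjoint)
open import Data.List.Relation.Binary.Subset.Propositional using (_⊆_)
open import Data.List.Relation.Unary.Any using (here; there)
open import Data.List.Relation.Unary.Unique.Propositional using (Unique; []; _∷_)
import Data.List.Relation.Unary.Unique.Propositional.Properties as Unique
open import Data.Nat.Base using (ℕ; zero; suc; _+_; _*_; _∸_; _≤_; _<_; z≤n; s≤s; z<s; pred; _⊓_; _<ᵇ_)
open import Data.Nat.Induction using (<-rec)
open import Data.Nat.Properties
  using ( _≤?_; ≤-refl; ≤-reflexive; ≤-trans; ≤-antisym; <-≤-trans; <⇒≱; <⇒≢; ≮⇒≥; ≰⇒>
        ; +-comm; +-suc; +-mono-≤; +-monoʳ-≤; +-mono-<-≤; +-mono-≤-<; *-identityʳ; *-zeroʳ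
        ; ∸-cancelʳ-≤; pred-mono-≤; m⊓n≤m; m⊓n≤n; <ᵇ⇒<
        ; +-commutativeSemigroup; +-0-commutativeMonoid; module ≤-Reasoning )
open import Algebra.Properties.CommutativeMonoid.Sum +-0-commutativeMonoid using (sum; ∑-distrib-+; sum-cong-≗)
open import Algebra.Properties.CommutativeSemigroup +-commutativeSemigroup using (interchange)
open import Data.Product.Base using (∃-syntax; _,_; _×_; proj₁; proj₂; uncurry)
import Data.Product.Properties as Product
open import Data.Sum.Base using (_⊎_; inj₁; inj₂; [_,_]′)
open import Data.Sum.Properties using (inj₁-injective; inj₂-injective)
import Data.Sum.Properties as Sum
open import Effect.Monad using (RawMonad)
open import Function.Base using (_∘_; flip; id)
open import Function.Bundles using (mk⇔; Equivalence)
open import Relation.Binary.PropositionalEquality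
  using (_≡_; _≢_; refl; sym; trans; cong; cong₂; subst; module ≡-Reasoning)
open import Relation.Nullary.Decidable.Core using (yes; no; T?; isYes; toWitness; fromWitness; ¬¬-excluded-middle)
open import Relation.Nullary.Negation using (¬_; contradiction; ¬¬-map; ¬¬-Monad)

open import Defs

private variable
  n m k : ℕ
  A B : Set
  G : Graph

toℕ : Bool → ℕ
toℕ false = 0
toℕ true  = 1

count : (Fin n → Bool) → ℕ
count P = sum (toℕ ∘ P)

_∩_ _∪_ : (Fin n → Bool) → (Fin n → Bool) → Fin n → Bool
(P ∩ Q) i = P i ∧ Q i
(P ∪ Q) i = P i ∨ Q i

sum-mono-≤ : {f g : Fin n → ℕ} → (∀ i → f i ≤ g i) → sum f ≤ sum g
sum-mono-≤ {zero}  f≤g = z≤n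
sum-mono-≤ {suc n} f≤g = +-mono-≤ (f≤g zero) (sum-mono-≤ (f≤g ∘ suc))

sum-mono-< : {f g : Fin n → ℕ} → (∀ i → f i ≤ g i) → ∀ i → f i < g i → sum f < sum g
sum-mono-< f≤g zero    f₀<g₀ = +-mono-<-≤ f₀<g₀ (sum-mono-≤ (f≤g ∘ suc))
sum-mono-< f≤g (suc i) fᵢ<gᵢ = +-mono-≤-< (f≤g zero) (sum-mono-< (f≤g ∘ suc) i fᵢ<gᵢ)

sum-≤-* : {f : Fin n → ℕ} → (∀ i → f i ≤ k) → sum f ≤ n * k
sum-≤-* {zero}  f≤k = z≤n
sum-≤-* {suc n} f≤k = +-mono-≤ (f≤k zero) (sum-≤-* (f≤k ∘ suc))

sum-positive : (f : Fin n → ℕ) → 0 < sum f → ∃[ i ] 0 < f i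
sum-positive {suc n} f 0<∑ with f zero in eq
... | suc _ = zero , subst (0 <_) (sym eq) z<s
... | zero  = let i , 0<fᵢ = sum-positive (f ∘ suc) 0<∑ in suc i , 0<fᵢ

count≤n : (P : Fin n → Bool) → count P ≤ n
count≤n {n} P = subst (count P ≤_) (*-identityʳ n) (sum-≤-* (toℕ≤1 ∘ P))
  where
  toℕ≤1 : ∀ b → toℕ b ≤ 1
  toℕ≤1 false = z≤n
  toℕ≤1 true  = s≤s z≤n

count-positive : (P : Fin n → Bool) → 0 < count P → ∃[ a ] T (P a)
count-positive P 0<count = let a , 0<Pa = sum-positive (toℕ ∘ P) 0<count in a , T-toℕ (P a) 0<Pa
  where
  T-toℕ : ∀ b → 0 < toℕ b → T b
  T-toℕ true _ = _

count-∩-∪ : (P Q : Fin n → Bool) → count (P ∩ Q) + count (P ∪ Q) ≡ count P + count Q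
count-∩-∪ P Q = begin
  count (P ∩ Q) + count (P ∪ Q)
    ≡⟨ ∑-distrib-+ (toℕ ∘ (P ∩ Q)) (toℕ ∘ (P ∪ Q)) ⟨
  sum (λ i → toℕ (P i ∧ Q i) + toℕ (P i ∨ Q i))
    ≡⟨ sum-cong-≗ (λ i → modular (P i) (Q i)) ⟩
  sum (λ i → toℕ (P i) + toℕ (Q i))
    ≡⟨ ∑-distrib-+ (toℕ ∘ P) (toℕ ∘ Q) ⟩
  count P + count Q
    ∎
  where
  open ≡-Reasoning
  modular : ∀ x y → toℕ (x ∧ y) + toℕ (x ∨ y) ≡ toℕ x + toℕ y
  modular false y     = refl
  modular true  false = refl
  modular true  true  = refl

count-∩⇒⊆ : (P Q : Fin n → Bool) → count Q ≤ count (P ∩ Q) → ∀ a → T (Q a) → T (P a)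
count-∩⇒⊆ P Q Q≤P∩Q a Qa with P a in eq
... | true  = _
... | false = contradiction Q≤P∩Q (<⇒≱ (sum-mono-< (λ i → ∧≤ (P i) (Q i)) a (∧< (P a) (Q a) eq Qa)))
  where
  ∧≤ : ∀ x y → toℕ (x ∧ y) ≤ toℕ y
  ∧≤ false y = z≤n
  ∧≤ true  y = ≤-refl
  ∧< : ∀ x y → x ≡ false → T y → toℕ (x ∧ y) < toℕ y
  ∧< false true _ _ = s≤s z≤n

¬¬-argmin : (f : A → ℕ) {Q : A → Set} {x : A} → Q x →
            ¬ ¬ (∃[ x ] Q x × ∀ {y} → Q y → f x ≤ f y)
¬¬-argmin f {Q} {x} Qx = <-rec Below step (f x) refl Qx
  where
  Below : ℕ → Set
  Below j = ∀ {x} → f x ≡ j → Q x → ¬ ¬ (∃[ x ] Q x × ∀ {y} → Q y → f x ≤ f y)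
  step : ∀ j → (∀ {i} → i < j → Below i) → Below j
  step _ below {x} refl Qx no-argmin = ¬¬-excluded-middle {A = ∃[ y ] Q y × f y < f x} λ where
    (yes (y , Qy , fy<fx)) → below fy<fx refl Qy no-argmin
    (no ∄y)               → no-argmin (x , Qx , λ {y} Qy → ≮⇒≥ λ fy<fx → ∄y (y , Qy , fy<fx))

¬¬-argmax : (f : A → ℕ) {Q : A → Set} {x : A} → (∀ {y} → Q y → f y ≤ k) → Q x →
            ¬ ¬ (∃[ x ] Q x × ∀ {y} → Q y → f y ≤ f x)
¬¬-argmax {k = k} f {Q} bounded Qx = ¬¬-map
  (λ (x , Qx , minimal) → x , Qx , λ {y} Qy → ∸-cancelʳ-≤ (bounded Qy) (minimal Qy))
  (¬¬-argmin (λ x → k ∸ f x) {Q = Q} Qx)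

unique-⊆⇒length≤ : {xs ys : List A} → Unique xs → xs ⊆ ys → length xs ≤ length ys
unique-⊆⇒length≤ [] _ = z≤n
unique-⊆⇒length≤ {xs = x ∷ xs} unique@(_ ∷ unique′) xs⊆ys with ∈-∃++ (xs⊆ys (here refl))
... | us , vs , refl = begin
  suc (length xs)             ≤⟨ s≤s (unique-⊆⇒length≤ unique′ xs⊆us++vs) ⟩
  suc (length (us ++ vs))     ≡⟨ cong suc (length-++ us) ⟩
  suc (length us + length vs) ≡⟨ +-suc (length us) (length vs) ⟨
  length us + length (x ∷ vs) ≡⟨ length-++ us ⟨
  length (us ++ x ∷ vs)       ∎
  where
  open ≤-Reasoning
  xs⊆us++vs : xs ⊆ us ++ vs
  xs⊆us++vs y∈xs with ∈-++⁻ us (xs⊆ys (there y∈xs))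
  ... | inj₁ y∈us         = ∈-++⁺ˡ y∈us
  ... | inj₂ (here refl)  = contradiction y∈xs (Unique.Unique[x∷xs]⇒x∉xs unique)
  ... | inj₂ (there y∈vs) = ∈-++⁺ʳ us y∈vs

length-cartesianProduct : (xs : List A) (ys : List B) → length (cartesianProduct xs ys) ≡ length xs * length ys
length-cartesianProduct []       ys = refl
length-cartesianProduct (x ∷ xs) ys =
  trans (length-++ (map (x ,_) ys)) (cong₂ _+_ (length-map (x ,_) ys) (length-cartesianProduct xs ys))

length-concat-tabulate : (f : Fin m → List A) → length (concat (tabulate f)) ≡ sum (length ∘ f)
length-concat-tabulate {m = zero}  f = refl
length-concat-tabulate {m = suc m} f =
  trans (length-++ (f zero)) (cong (length (f zero) +_) (length-concat-tabulate (f ∘ suc)))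

inj₁∉map-inj₂ : {a : A} {ys : List B} → inj₁ a ∉ map inj₂ ys
inj₁∉map-inj₂ a∈ with ∈-map⁻ inj₂ a∈
... | _ , _ , ()

inj₂∉map-inj₁ : {b : B} {xs : List A} → inj₂ b ∉ map inj₁ xs
inj₂∉map-inj₁ b∈ with ∈-map⁻ inj₁ b∈
... | _ , _ , ()

elements : (Fin n → Bool) → List (Fin n)
elements {n} P = filter (T? ∘ P) (allFin n)

module _ {P : Fin n → Bool} where

  ∈-elements⁺ : ∀ {a} → T (P a) → a ∈ elements P
  ∈-elements⁺ {a} = ∈-filter⁺ (T? ∘ P) (∈-allFin a)

  ∈-elements⁻ : ∀ {a} → a ∈ elements P → T (P a)
  ∈-elements⁻ = proj₂ ∘ ∈-filter⁻ (T? ∘ P) {xs = allFin n}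

  elements-unique : Unique (elements P)
  elements-unique = Unique.filter⁺ (T? ∘ P) (Unique.allFin⁺ n)

length-filter-tabulate : (P : A → Bool) (f : Fin n → A) →
                         length (filter (T? ∘ P) (tabulate f)) ≡ count (P ∘ f)
length-filter-tabulate {n = zero}  P f = refl
length-filter-tabulate {n = suc n} P f with P (f zero)
... | true  = cong suc (length-filter-tabulate P (f ∘ suc))
... | false = length-filter-tabulate P (f ∘ suc)

length-elements : (P : Fin n → Bool) → length (elements P) ≡ count P
length-elements P = length-filter-tabulate P id

layers : (Fin m → Fin n → A) → (Fin m → Fin n → Bool) → List A
layers g P = concat (tabulate λ c → map (g c) (elements (P c)))

∈-layers⁺ : (g : Fin m → Fin n → A) {P : Fin m → Fin n → Bool} →
            ∀ {c a} → T (P c a) → g c a ∈ layers g P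
∈-layers⁺ g {c = c} Pca = ∈-concat⁺′ (∈-map⁺ (g c) (∈-elements⁺ Pca)) (∈-tabulate⁺ c)

length-layers : (g : Fin m → Fin n → A) (P : Fin m → Fin n → Bool) →
                length (layers g P) ≡ sum (count ∘ P)
length-layers g P = trans (length-concat-tabulate λ c → map (g c) (elements (P c)))
                          (sum-cong-≗ λ c → trans (length-map (g c) (elements (P c))) (length-elements (P c)))

stable-⊆ : ∀ {G} {S : List (V G)} {R : V G → V G → Set} → (∀ {u v} → R u v → Adj G u v) →
           IsStable G S → IsStable (record { V = V G ; Adj = R }) S
stable-⊆ R⊆Adj (unique , independent) = unique , λ u∈S v∈S → independent u∈S v∈S ∘ R⊆Adj

stable-addEdge : ∀ {x y S} → IsStable G S → x ∉ S → IsStable (addEdge G x y) S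
stable-addEdge (unique , independent) x∉S = unique , λ where
  u∈S v∈S (inj₁ uv)                → independent u∈S v∈S uv
  u∈S v∈S (inj₂ (inj₁ (refl , _))) → x∉S u∈S
  u∈S v∈S (inj₂ (inj₂ (_ , refl))) → x∉S v∈S

SamePair-swap : {X : Set} {u v x y : X} → SamePair u v x y → SamePair u v y x
SamePair-swap (inj₁ (u≡x , v≡y)) = inj₂ (u≡x , v≡y)
SamePair-swap (inj₂ (u≡y , v≡x)) = inj₁ (u≡y , v≡x)

stable-deleteEdge-swap : ∀ {x y S} → IsStable (deleteEdge G x y) S → IsStable (deleteEdge G y x) S
stable-deleteEdge-swap {G = G} {x} {y} =
  stable-⊆ {G = deleteEdge G x y} λ (uv , ¬xy) → uv , ¬xy ∘ SamePair-swap

IsAlpha-deleteEdge-swap : ∀ {x y} → IsAlpha (deleteEdge G x y) k → IsAlpha (deleteEdge G y x) k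
IsAlpha-deleteEdge-swap ((S , stable , length≡k) , bounded) =
  (S , stable-deleteEdge-swap stable , length≡k) , λ S′ → bounded S′ ∘ stable-deleteEdge-swap

addEdge-IsAlpha : ∀ {x y S} → IsAlpha G k → IsStable G S → length S ≡ k → x ∉ S →
                  IsAlpha (addEdge G x y) k
addEdge-IsAlpha {G = G} {x = x} {y} αG stable length≡k x∉S =
  (_ , stable-addEdge stable x∉S , length≡k) ,
  λ S′ → proj₂ αG S′ ∘ stable-⊆ {G = addEdge G x y} inj₁

IsAlpha-unique : ∀ {k′} → IsAlpha G k → IsAlpha G k′ → k ≡ k′
IsAlpha-unique ((S , stable , refl) , bounded) ((S′ , stable′ , refl) , bounded′) =
  ≤-antisym (bounded′ S stable) (bounded S′ stable′)

sameAlpha : ∀ {G′} → IsAlpha G k → IsAlpha G′ k → SameAlpha G G′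
sameAlpha {G = G} {G′ = G′} αG αG′ j = mk⇔
  (λ αGj → subst (IsAlpha G′) (IsAlpha-unique αG αGj) αG′)
  (λ αG′j → subst (IsAlpha G) (IsAlpha-unique αG′ αG′j) αG)

module _ {E : A → B → Set} where

  inj₁-stable : ∀ {xs} → Unique xs → IsStable (bip A B E) (map inj₁ xs)
  inj₁-stable {xs} unique = Unique.map⁺ inj₁-injective unique , independent
    where
    independent : ∀ {u v} → u ∈ map inj₁ xs → v ∈ map inj₁ xs → ¬ Adj (bip A B E) u v
    independent u∈ v∈ with ∈-map⁻ inj₁ u∈ | ∈-map⁻ inj₁ v∈
    ... | _ , _ , refl | _ , _ , refl = λ ()

  inj₂-stable : ∀ {ys} → Unique ys → IsStable (bip A B E) (map inj₂ ys)
  inj₂-stable {ys} unique = Unique.map⁺ inj₂-injective unique , independent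
    where
    independent : ∀ {u v} → u ∈ map inj₂ ys → v ∈ map inj₂ ys → ¬ Adj (bip A B E) u v
    independent u∈ v∈ with ∈-map⁻ inj₂ u∈ | ∈-map⁻ inj₂ v∈
    ... | _ , _ , refl | _ , _ , refl = λ ()

record StablePair (E : BipEdges n) (P Q : Fin n → Bool) : Set where
  constructor stablePair
  field no-edge : ∀ {a b} → T (P a) → T (Q b) → ¬ E a b
open StablePair

size : (Fin n → Bool) → (Fin n → Bool) → ℕ
size P Q = count P + count Q

PairBound : BipEdges n → ℕ → Set
PairBound E k = ∀ {P Q} → StablePair E P Q → size P Q ≤ k

StableBound : Graph → ℕ → Set
StableBound G k = ∀ S → IsStable G S → length S ≤ k

pairList : (Fin n → Bool) → (Fin n → Bool) → List (Fin n ⊎ Fin n)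
pairList P Q = map inj₁ (elements P) ++ map inj₂ (elements Q)

length-pairList : (P Q : Fin n → Bool) → length (pairList P Q) ≡ size P Q
length-pairList P Q = begin
  length (pairList P Q)
    ≡⟨ length-++ (map inj₁ (elements P)) ⟩
  length (map inj₁ (elements P)) + length (map inj₂ (elements Q))
    ≡⟨ cong₂ _+_ (length-map inj₁ (elements P)) (length-map inj₂ (elements Q)) ⟩
  length (elements P) + length (elements Q)
    ≡⟨ cong₂ _+_ (length-elements P) (length-elements Q) ⟩
  size P Q
    ∎
  where open ≡-Reasoning

module _ {P Q : Fin n → Bool} where

  ∈-pairList⁺ : ∀ {u} → T ([ P , Q ]′ u) → u ∈ pairList P Q
  ∈-pairList⁺ {inj₁ a} Pa = ∈-++⁺ˡ (∈-map⁺ inj₁ (∈-elements⁺ Pa))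
  ∈-pairList⁺ {inj₂ b} Qb = ∈-++⁺ʳ _ (∈-map⁺ inj₂ (∈-elements⁺ Qb))

  ∈-pairList⁻ : ∀ {u} → u ∈ pairList P Q → T ([ P , Q ]′ u)
  ∈-pairList⁻ u∈ with ∈-++⁻ (map inj₁ (elements P)) u∈
  ... | inj₁ u∈ₗ with ∈-map⁻ inj₁ u∈ₗ
  ...   | _ , a∈ , refl = ∈-elements⁻ a∈
  ∈-pairList⁻ u∈ | inj₂ u∈ᵣ with ∈-map⁻ inj₂ u∈ᵣ
  ...   | _ , b∈ , refl = ∈-elements⁻ b∈

  pairList-stable : {E : BipEdges n} → StablePair E P Q → IsStable (balanced n E) (pairList P Q)
  pairList-stable {E} stable =
    unique , λ {u} {v} u∈ v∈ → independent u v (∈-pairList⁻ u∈) (∈-pairList⁻ v∈)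
    where
    disjoint : Disjoint (map inj₁ (elements P)) (map inj₂ (elements Q))
    disjoint (u∈ₗ , u∈ᵣ) = inj₁∉map-inj₂ (subst (_∈ _) (proj₂ (proj₂ (∈-map⁻ inj₁ u∈ₗ))) u∈ᵣ)
    unique : Unique (pairList P Q)
    unique = Unique.++⁺ (Unique.map⁺ inj₁-injective elements-unique)
                        (Unique.map⁺ inj₂-injective elements-unique) disjoint
    independent : ∀ u v → T ([ P , Q ]′ u) → T ([ P , Q ]′ v) → ¬ Adj (balanced n E) u v
    independent (inj₁ a) (inj₂ b) Pa Qb = no-edge stable Pa Qb
    independent (inj₂ b) (inj₁ a) Qb Pa = no-edge stable Pa Qb
    independent (inj₁ _) (inj₁ _) _ _ ()
    independent (inj₂ _) (inj₂ _) _ _ ()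

module _ {n : ℕ} where
  open import Data.List.Membership.DecPropositional (Sum.≡-dec (_≟_ {n}) (_≟_ {n})) using (_∈?_)

  leftOf rightOf : List (Fin n ⊎ Fin n) → Fin n → Bool
  leftOf  S a = isYes (inj₁ a ∈? S)
  rightOf S b = isYes (inj₂ b ∈? S)

  module _ {S : List (Fin n ⊎ Fin n)} where

    ∈⇒T-sides : ∀ {u} → u ∈ S → T ([ leftOf S , rightOf S ]′ u)
    ∈⇒T-sides {inj₁ _} = fromWitness
    ∈⇒T-sides {inj₂ _} = fromWitness

    T-sides⇒∈ : ∀ u → T ([ leftOf S , rightOf S ]′ u) → u ∈ S
    T-sides⇒∈ (inj₁ _) = toWitness
    T-sides⇒∈ (inj₂ _) = toWitness

    length≤size : Unique S → length S ≤ size (leftOf S) (rightOf S)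
    length≤size unique = begin
      length S                                 ≤⟨ unique-⊆⇒length≤ unique (∈-pairList⁺ ∘ ∈⇒T-sides) ⟩
      length (pairList (leftOf S) (rightOf S)) ≡⟨ length-pairList (leftOf S) (rightOf S) ⟩
      size (leftOf S) (rightOf S)              ∎
      where open ≤-Reasoning

    stable⇒StablePair : {E : BipEdges n} → IsStable (balanced n E) S → StablePair E (leftOf S) (rightOf S)
    stable⇒StablePair (_ , independent) = stablePair λ Pa Qb → independent (toWitness Pa) (toWitness Qb)

module _ {E : BipEdges n} where

  PairBound⇒StableBound : PairBound E k → StableBound (balanced n E) k
  PairBound⇒StableBound bounded S stable =
    ≤-trans (length≤size (proj₁ stable)) (bounded (stable⇒StablePair stable))

  StableBound⇒PairBound : StableBound (balanced n E) k → PairBound E k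
  StableBound⇒PairBound bounded {P} {Q} stable =
    subst (_≤ _) (length-pairList P Q) (bounded _ (pairList-stable stable))

  maximumPair⇒IsAlpha : ∀ {P Q} → PairBound E k → StablePair E P Q → size P Q ≡ k →
                        IsAlpha (balanced n E) k
  maximumPair⇒IsAlpha {P = P} {Q} bounded stable size≡k =
    (pairList P Q , pairList-stable stable , trans (length-pairList P Q) size≡k) , PairBound⇒StableBound bounded

flip-stable : {E : BipEdges n} {P Q : Fin n → Bool} → StablePair E P Q → StablePair (flip E) Q P
flip-stable stable = stablePair λ Qb Pa → no-edge stable Pa Qb

meet-stable : {E : BipEdges n} {P Q P′ Q′ : Fin n → Bool} →
              StablePair E P Q → StablePair E P′ Q′ → StablePair E (P ∩ P′) (Q ∪ Q′)
meet-stable {E = E} {P} {Q} {P′} {Q′} stable stable′ = stablePair no-edge-meet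
  where
  no-edge-meet : ∀ {a b} → T ((P ∩ P′) a) → T ((Q ∪ Q′) b) → ¬ E a b
  no-edge-meet {a} {b} PP′a QQ′b with Equivalence.to (T-∧ {P a}) PP′a | Equivalence.to (T-∨ {Q b}) QQ′b
  ... | Pa , _  | inj₁ Qb  = no-edge stable Pa Qb
  ... | _ , P′a | inj₂ Q′b = no-edge stable′ P′a Q′b

join-stable : {E : BipEdges n} {P Q P′ Q′ : Fin n → Bool} →
              StablePair E P Q → StablePair E P′ Q′ → StablePair E (P ∪ P′) (Q ∩ Q′)
join-stable stable stable′ = flip-stable (meet-stable (flip-stable stable) (flip-stable stable′))

size-modular : (P Q P′ Q′ : Fin n → Bool) →
               size (P ∩ P′) (Q ∪ Q′) + size (P ∪ P′) (Q ∩ Q′) ≡ size P Q + size P′ Q′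
size-modular P Q P′ Q′ = begin
  size (P ∩ P′) (Q ∪ Q′) + size (P ∪ P′) (Q ∩ Q′)
    ≡⟨ interchange (count (P ∩ P′)) (count (Q ∪ Q′)) (count (P ∪ P′)) (count (Q ∩ Q′)) ⟩
  (count (P ∩ P′) + count (P ∪ P′)) + (count (Q ∪ Q′) + count (Q ∩ Q′))
    ≡⟨ cong₂ _+_ (count-∩-∪ P P′) (trans (+-comm (count (Q ∪ Q′)) _) (count-∩-∪ Q Q′)) ⟩
  (count P + count P′) + (count Q + count Q′)
    ≡⟨ interchange (count P) (count P′) (count Q) (count Q′) ⟩
  size P Q + size P′ Q′
    ∎
  where open ≡-Reasoning

x+y≡k+k⇒x≡k : ∀ {x y} → x ≤ k → y ≤ k → x + y ≡ k + k → x ≡ k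
x+y≡k+k⇒x≡k x≤k y≤k x+y≡k+k =
  ≤-antisym x≤k (≮⇒≥ λ x<k → <⇒≢ (+-mono-<-≤ x<k y≤k) x+y≡k+k)

meet-maximum : {E : BipEdges n} {P Q P′ Q′ : Fin n → Bool} → PairBound E k →
               StablePair E P Q → size P Q ≡ k → StablePair E P′ Q′ → size P′ Q′ ≡ k →
               size (P ∩ P′) (Q ∪ Q′) ≡ k
meet-maximum {P = P} {Q} {P′} {Q′} bounded stable size≡k stable′ size′≡k = x+y≡k+k⇒x≡k
  (bounded (meet-stable stable stable′)) (bounded (join-stable stable stable′))
  (trans (size-modular P Q P′ Q′) (cong₂ _+_ size≡k size′≡k))

InCore : BipEdges n → ℕ → Fin n ⊎ Fin n → Set
InCore E k u = ∀ {P Q} → StablePair E P Q → size P Q ≡ k → T ([ P , Q ]′ u)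

positive-summand : ∀ {x y} → y ≤ n → n < x + y → 0 < x
positive-summand {x = zero}  y≤n n<y = contradiction y≤n (<⇒≱ n<y)
positive-summand {x = suc _} _   _   = z<s

module _ {E : BipEdges n} where

  ¬¬-left-core-vertex : ∀ {P Q} → PairBound E k → n < k → StablePair E P Q → size P Q ≡ k →
                        ¬ ¬ (∃[ a ] InCore E k (inj₁ a))
  ¬¬-left-core-vertex {k = k} {P} {Q} bounded n<k stable size≡k =
    ¬¬-map core (¬¬-argmin (count ∘ proj₁) {Q = Maximum} {x = P , Q} (stable , size≡k))
    where
    Maximum : (Fin n → Bool) × (Fin n → Bool) → Set
    Maximum (P , Q) = StablePair E P Q × size P Q ≡ k
    core : (∃[ PQ ] Maximum PQ × ∀ {PQ′} → Maximum PQ′ → count (proj₁ PQ) ≤ count (proj₁ PQ′)) →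
           ∃[ a ] InCore E k (inj₁ a)
    core ((Pₘ , Qₘ) , (stableₘ , sizeₘ) , minimal) =
      let a , Pₘa = count-positive Pₘ (positive-summand (count≤n Qₘ) (subst (n <_) (sym sizeₘ) n<k))
      in a , λ {P} stable size≡k → count-∩⇒⊆ P Pₘ
               (minimal (meet-stable stable stableₘ , meet-maximum bounded stable size≡k stableₘ sizeₘ)) a Pₘa

  PairBound-flip : PairBound E k → PairBound (flip E) k
  PairBound-flip {k} bounded {Q} {P} stable =
    subst (_≤ k) (+-comm (count P) (count Q)) (bounded (flip-stable stable))

  InCore-flip : ∀ {b} → InCore (flip E) k (inj₁ b) → InCore E k (inj₂ b)
  InCore-flip b∈core {P} {Q} stable size≡k =
    b∈core (flip-stable stable) (trans (+-comm (count Q) (count P)) size≡k)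

  α⁺-stable⇒¬core-pair : ∀ {P Q x y} → α⁺-stable (balanced n E) →
                          PairBound E k → StablePair E P Q → size P Q ≡ k →
                          InCore E k (inj₁ x) → InCore E k (inj₂ y) → ⊥
  α⁺-stable⇒¬core-pair {k} {x = x} {y} α⁺ bounded stable size≡k x∈core y∈core =
    absurd (Equivalence.to (α⁺ (inj₁ x) (inj₂ y) (λ ()) x≁y k)
                           (maximumPair⇒IsAlpha bounded stable size≡k))
    where
    x≁y : ¬ E x y
    x≁y = no-edge stable (x∈core stable size≡k) (y∈core stable size≡k)
    absurd : IsAlpha (addEdge (balanced n E) (inj₁ x) (inj₂ y)) k → ⊥
    absurd ((S , stable⁺ , length≡k) , _) =
      proj₂ stable⁺ (∈S x∈core) (∈S y∈core) (inj₂ (inj₁ (refl , refl)))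
      where
      stableS : IsStable (balanced n E) S
      stableS = stable-⊆ {G = addEdge (balanced n E) (inj₁ x) (inj₂ y)} inj₁ stable⁺
      maximumS : size (leftOf S) (rightOf S) ≡ k
      maximumS = ≤-antisym (bounded (stable⇒StablePair stableS))
                           (subst (_≤ _) length≡k (length≤size (proj₁ stableS)))
      ∈S : ∀ {u} → InCore E k u → u ∈ S
      ∈S {u} u∈core = T-sides⇒∈ u (u∈core (stable⇒StablePair stableS) maximumS)

-- E is an arbitrary relation, so stability of a pair is undecidable and the extremal pairs exist
-- only under double negation; the goal is decidable, which lets the argument run inside ¬ ¬.
α⁺-stable⇒PairBound : {E : BipEdges n} → α⁺-stable (balanced n E) → PairBound E n
α⁺-stable⇒PairBound {n} {E} α⁺ {P} {Q} stable with size P Q ≤? n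
... | yes size≤n = size≤n
... | no  size≰n = ⊥-elim (absurd id)
  where
  open RawMonad ¬¬-Monad
  absurd : ¬ ¬ ⊥
  absurd = do
    ((P₁ , Q₁) , stable₁ , maximal) ← ¬¬-argmax (uncurry size) {Q = uncurry (StablePair E)}
      (λ {(P′ , Q′)} _ → +-mono-≤ (count≤n P′) (count≤n Q′)) stable
    let bounded : PairBound E (size P₁ Q₁)
        bounded = maximal
        n<k : n < size P₁ Q₁
        n<k = <-≤-trans (≰⇒> size≰n) (maximal stable)
    x , x∈core ← ¬¬-left-core-vertex bounded n<k stable₁ refl
    y , y∈core ← ¬¬-left-core-vertex (PairBound-flip bounded) n<k (flip-stable stable₁)
                                     (+-comm (count Q₁) (count P₁))
    pure (α⁺-stable⇒¬core-pair α⁺ bounded stable₁ refl x∈core (InCore-flip y∈core))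

balanced-IsAlpha : {E : BipEdges n} → PairBound E n → IsAlpha (balanced n E) n
balanced-IsAlpha {n} bounded =
  (map inj₁ (allFin n) , inj₁-stable (Unique.allFin⁺ n) ,
   trans (length-map inj₁ (allFin n)) (length-tabulate {n = n} id)) ,
  PairBound⇒StableBound bounded

_∖_ : BipEdges n → Fin n × Fin n → BipEdges n
(E ∖ e) a b = E a b × (a , b) ≢ e

deleteEdge-PairBound : {E : BipEdges n} → α⁻-stable (balanced n E) → IsAlpha (balanced n E) n →
                       ∀ {a₀ b₀} → E a₀ b₀ → PairBound (E ∖ (a₀ , b₀)) n
deleteEdge-PairBound {n} {E} α⁻ αG {a₀} {b₀} e =
  StableBound⇒PairBound λ S stable →
    proj₂ αG−e S (stable-⊆ {G = balanced n (E ∖ (a₀ , b₀))} shrink stable)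
  where
  αG−e : IsAlpha (deleteEdge (balanced n E) (inj₁ a₀) (inj₂ b₀)) n
  αG−e = Equivalence.to (α⁻ (inj₁ a₀) (inj₂ b₀) e n) αG
  shrink : ∀ {u v} → Adj (deleteEdge (balanced n E) (inj₁ a₀) (inj₂ b₀)) u v →
                     Adj (balanced n (E ∖ (a₀ , b₀))) u v
  shrink {inj₁ a} {inj₂ b} (Eab , ¬same) = Eab , λ { refl → ¬same (inj₁ (refl , refl)) }
  shrink {inj₂ b} {inj₁ a} (Eab , ¬same) = Eab , λ { refl → ¬same (inj₂ (refl , refl)) }
  shrink {inj₁ _} {inj₁ _} (() , _)
  shrink {inj₂ _} {inj₂ _} (() , _)

bottom-layer : ∀ x → x ≡ toℕ (0 <ᵇ x) + pred x
bottom-layer zero    = refl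
bottom-layer (suc x) = refl

top-layer : ∀ {x} k → x ≤ suc k → x ≡ toℕ (k <ᵇ x) + x ⊓ k
top-layer {zero}     k       _           = refl
top-layer {suc zero} zero    _           = refl
top-layer {suc x}    (suc k) (s≤s x≤1+k) = trans (cong suc (top-layer k x≤1+k)) (sym (+-suc _ _))

pred+⊓≤ : ∀ {x y} k → x + y ≤ suc k → pred x + y ⊓ k ≤ k
pred+⊓≤ {zero}  {y} k _           = m⊓n≤n y k
pred+⊓≤ {suc x} {y} k (s≤s x+y≤k) = ≤-trans (+-monoʳ-≤ x (m⊓n≤m y k)) x+y≤k

weighted-bound : {F : BipEdges m} → PairBound F m → ∀ k {s t : Fin m → ℕ} →
                 (∀ c → s c ≤ k) → (∀ d → t d ≤ k) → (∀ {c d} → F c d → s c + t d ≤ k) →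
                 sum s + sum t ≤ k * m
weighted-bound {m} _ zero s≤0 t≤0 _ =
  ≤-trans (+-mono-≤ (sum-≤-* s≤0) (sum-≤-* t≤0)) (≤-reflexive (cong₂ _+_ (*-zeroʳ m) (*-zeroʳ m)))
weighted-bound {m} {F} bounded (suc k) {s} {t} s≤ t≤ edge = begin
  sum s + sum t
    ≡⟨ cong₂ _+_ split-s split-t ⟩
  (count X + sum s′) + (count Y + sum t′)
    ≡⟨ interchange (count X) (sum s′) (count Y) (sum t′) ⟩
  (count X + count Y) + (sum s′ + sum t′)
    ≤⟨ +-mono-≤ (bounded layer-stable) (weighted-bound bounded k s′≤ t′≤ edge′) ⟩
  m + k * m
    ∎
  where
  open ≤-Reasoning
  X Y : Fin m → Bool
  X c = 0 <ᵇ s c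
  Y d = k <ᵇ t d
  s′ t′ : Fin m → ℕ
  s′ c = pred (s c)
  t′ d = t d ⊓ k
  split-s : sum s ≡ count X + sum s′
  split-s = trans (sum-cong-≗ (bottom-layer ∘ s)) (∑-distrib-+ (toℕ ∘ X) s′)
  split-t : sum t ≡ count Y + sum t′
  split-t = trans (sum-cong-≗ (λ d → top-layer k (t≤ d))) (∑-distrib-+ (toℕ ∘ Y) t′)
  layer-stable : StablePair F X Y
  layer-stable = stablePair λ {c} {d} Xc Yd Fcd →
    <⇒≱ (+-mono-≤ (<ᵇ⇒< 0 (s c) Xc) (<ᵇ⇒< k (t d) Yd)) (edge Fcd)
  s′≤ : ∀ c → s′ c ≤ k
  s′≤ c = pred-mono-≤ (s≤ c)
  t′≤ : ∀ d → t′ d ≤ k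
  t′≤ d = m⊓n≤n (t d) k
  edge′ : ∀ {c d} → F c d → s′ c + t′ d ≤ k
  edge′ {c} {d} Fcd = pred+⊓≤ {s c} {t d} k (edge Fcd)

module _ {n m : ℕ} where

  private
    Vertex : Set
    Vertex = (Fin n × Fin m) ⊎ (Fin n × Fin m)

  open import Data.List.Membership.DecPropositional
    (Sum.≡-dec (Product.≡-dec (_≟_ {n}) (_≟_ {m})) (Product.≡-dec (_≟_ {n}) (_≟_ {m}))) using (_∈?_)

  fibreₗ fibreᵣ : List Vertex → Fin m → Fin n → Bool
  fibreₗ S c a = isYes (inj₁ (a , c) ∈? S)
  fibreᵣ S d b = isYes (inj₂ (b , d) ∈? S)

  length≤fibres : ∀ {S} → Unique S → length S ≤ sum (count ∘ fibreₗ S) + sum (count ∘ fibreᵣ S)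
  length≤fibres {S} unique = begin
    length S
      ≤⟨ unique-⊆⇒length≤ unique S⊆fibres ⟩
    length (fibresₗ ++ fibresᵣ)
      ≡⟨ length-++ fibresₗ ⟩
    length fibresₗ + length fibresᵣ
      ≡⟨ cong₂ _+_ (length-layers gₗ (fibreₗ S)) (length-layers gᵣ (fibreᵣ S)) ⟩
    sum (count ∘ fibreₗ S) + sum (count ∘ fibreᵣ S)
      ∎
    where
    open ≤-Reasoning
    gₗ gᵣ : Fin m → Fin n → Vertex
    gₗ c a = inj₁ (a , c)
    gᵣ d b = inj₂ (b , d)
    fibresₗ fibresᵣ : List Vertex
    fibresₗ = layers gₗ (fibreₗ S)
    fibresᵣ = layers gᵣ (fibreᵣ S)
    S⊆fibres : S ⊆ fibresₗ ++ fibresᵣ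
    S⊆fibres {inj₁ _} u∈S = ∈-++⁺ˡ (∈-layers⁺ gₗ (fromWitness u∈S))
    S⊆fibres {inj₂ _} u∈S = ∈-++⁺ʳ fibresₗ (∈-layers⁺ gᵣ (fromWitness u∈S))

  stable⇒fibres-stable : ∀ {R : Vertex → Vertex → Set} {E′ : BipEdges n} {F : BipEdges m} {S} →
                         IsStable (record { V = Vertex ; Adj = R }) S →
                         (∀ {a b c d} → E′ a b → F c d → R (inj₁ (a , c)) (inj₂ (b , d))) →
                         ∀ {c d} → F c d → StablePair E′ (fibreₗ S c) (fibreᵣ S d)
  stable⇒fibres-stable (_ , independent) edge Fcd =
    stablePair λ Pa Qb E′ab → independent (toWitness Pa) (toWitness Qb) (edge E′ab Fcd)

  fibres-stable⇒length≤ : ∀ {E′ : BipEdges n} {F : BipEdges m} → PairBound E′ n → PairBound F m →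
                          ∀ {S} → Unique S → (∀ {c d} → F c d → StablePair E′ (fibreₗ S c) (fibreᵣ S d)) →
                          length S ≤ n * m
  fibres-stable⇒length≤ boundE′ boundF {S} unique fibres = begin
    length S
      ≤⟨ length≤fibres unique ⟩
    sum (count ∘ fibreₗ S) + sum (count ∘ fibreᵣ S)
      ≤⟨ weighted-bound boundF n (count≤n ∘ fibreₗ S) (count≤n ∘ fibreᵣ S) (boundE′ ∘ fibres) ⟩
    n * m
      ∎
    where open ≤-Reasoning

allPairs : ∀ n m → List (Fin n × Fin m)
allPairs n m = cartesianProduct (allFin n) (allFin m)

allPairs-unique : ∀ n m → Unique (allPairs n m)
allPairs-unique n m = Unique.cartesianProduct⁺ (Unique.allFin⁺ n) (Unique.allFin⁺ m)

length-map-allPairs : ∀ n m (f : Fin n × Fin m → A) → length (map f (allPairs n m)) ≡ n * m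
length-map-allPairs n m f = begin
  length (map f (allPairs n m))
    ≡⟨ length-map f (allPairs n m) ⟩
  length (allPairs n m)
    ≡⟨ length-cartesianProduct (allFin n) (allFin m) ⟩
  length (allFin n) * length (allFin m)
    ≡⟨ cong₂ _*_ (length-tabulate {n = n} id) (length-tabulate {n = m} id) ⟩
  n * m
    ∎
  where open ≡-Reasoning

module _ {E : BipEdges n} {F : BipEdges m} where

  kron-IsAlpha : PairBound E n → PairBound F m → IsAlpha (kron E F) (n * m)
  kron-IsAlpha boundE boundF =
    (map inj₁ (allPairs n m) , inj₁-stable (allPairs-unique n m) , length-map-allPairs n m inj₁) ,
    λ S stable → fibres-stable⇒length≤ boundE boundF (proj₁ stable) (stable⇒fibres-stable stable _,_)

  kron-α⁺-stable : IsAlpha (kron E F) (n * m) → α⁺-stable (kron E F)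
  kron-α⁺-stable αK (inj₁ _) _ _ _ = sameAlpha αK
    (addEdge-IsAlpha αK (inj₂-stable (allPairs-unique n m)) (length-map-allPairs n m inj₂) inj₁∉map-inj₂)
  kron-α⁺-stable αK (inj₂ _) _ _ _ = sameAlpha αK
    (addEdge-IsAlpha αK (inj₁-stable (allPairs-unique n m)) (length-map-allPairs n m inj₁) inj₂∉map-inj₁)

  kron-deleteEdge-IsAlpha : ∀ {a₀ b₀ c₀ d₀} → IsAlpha (kron E F) (n * m) →
                            PairBound (E ∖ (a₀ , b₀)) n → PairBound F m →
                            IsAlpha (deleteEdge (kron E F) (inj₁ (a₀ , c₀)) (inj₂ (b₀ , d₀))) (n * m)
  kron-deleteEdge-IsAlpha ((S , stable , length≡) , _) boundE∖e boundF =
    (S , stable-⊆ {G = kron E F} proj₁ stable , length≡) ,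
    λ S′ stable′ → fibres-stable⇒length≤ boundE∖e boundF (proj₁ stable′)
                                         (stable⇒fibres-stable stable′ edge)
    where
    edge : ∀ {a b c d} → (E ∖ _) a b → F c d →
           Adj (deleteEdge (kron E F) _ _) (inj₁ (a , c)) (inj₂ (b , d))
    edge (Eab , ab≢e) Fcd = (Eab , Fcd) , λ { (inj₁ (refl , refl)) → ab≢e refl ; (inj₂ (() , _)) }

  kron-α⁻-stable : IsAlpha (kron E F) (n * m) →
                   (∀ {a₀ b₀} → E a₀ b₀ → PairBound (E ∖ (a₀ , b₀)) n) → PairBound F m →
                   α⁻-stable (kron E F)
  kron-α⁻-stable αK boundE∖ boundF (inj₁ _) (inj₂ _) (e , _) =
    sameAlpha αK (kron-deleteEdge-IsAlpha αK (boundE∖ e) boundF)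
  kron-α⁻-stable αK boundE∖ boundF (inj₂ _) (inj₁ _) (e , _) =
    sameAlpha αK (IsAlpha-deleteEdge-swap (kron-deleteEdge-IsAlpha αK (boundE∖ e) boundF))
  kron-α⁻-stable _ _ _ (inj₁ _) (inj₁ _) ()
  kron-α⁻-stable _ _ _ (inj₂ _) (inj₂ _) ()

proposition12 : (n m : ℕ) (E : BipEdges n) (F : BipEdges m) →
    α-stable (balanced n E) → α⁺-stable (balanced m F) →
    α-stable (kron E F)
proposition12 n m E F (α⁻G , α⁺G) α⁺H =
  kron-α⁻-stable αK (deleteEdge-PairBound α⁻G (balanced-IsAlpha boundG)) boundH , kron-α⁺-stable αK
  where
  boundG : PairBound E n
  boundG = α⁺-stable⇒PairBound α⁺G
  boundH : PairBound F m
  boundH = α⁺-stable⇒PairBound α⁺H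
  αK : IsAlpha (kron E F) (n * m)
  αK = kron-IsAlpha boundG boundH
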